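{- Let $\lambda$ be a nonzero real number. For integers $n\ge 0$ and real $x$, let $(x)_{0,\lambda}=1$ and $(x)_{n,\lambda}=x(x-\lambda)(x-2\lambda)\cdots(x-(n-1)\lambda)$ for $n\ge1$. Define the degenerate exponential $e_{\lambda}^{x}(t)=\sum_{k=0}^{\infty}(x)_{k,\lambda}\frac{t^{k}}{k!}$, with $e_\lambda(t)=e_\lambda^1(t)$. Define the degenerate Eulerian polynomials $A_{n,\lambda}(x)$, $n\ge0$, by \[\sum_{j=0}^{\infty}(j+1)_{n,\lambda}x^{j}=\frac{A_{n,\lambda}(x)}{(1-x)^{n+1}},\qquad |x|<1.\] Then \[\frac{x-1}{x-e_{ -\lambda}((x-1)t)}=\sum_{n=0}^{\infty}A_{n,\lambda}(x)\frac{t^{n}}{n!}.\]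
   Context: Here $e_{ -\lambda}$ denotes the degenerate exponential with parameter $-\lambda$, i.e. $e_{ -\lambda}(t)=\sum_{k\ge0}(1)_{k,-\lambda}t^k/k!$. The identity is as formal power series in $t$ (equivalently for $t$ near $0$). -}

module Defs where

open import Level using (Level; _⊔_) renaming (suc to lsuc)
open import Algebra.Bundles using (CommutativeRing)
open import Data.Nat as ℕ using (ℕ; zero; suc)
open import Data.Nat.Combinatorics using (_C_)
open import Data.Fin using (Fin; toℕ)
open import Data.Vec as Vec using (Vec; []; _∷_)
open import Data.List as List using (List; []; _∷_)
open import Relation.Nullary using (¬_)

module _ {c ℓ} (R : CommutativeRing c ℓ) where
  open CommutativeRing R
  ι : ℕ → Carrier
  ι zero    = 0#
  ι (suc n) = 1# + ι n

record Char0Field (c ℓ : Level) : Set (lsuc (c ⊔ ℓ)) where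
  field
    commRing : CommutativeRing c ℓ
  open CommutativeRing commRing
  field
    _⁻¹       : Carrier → Carrier
    ⁻¹-cong   : ∀ {a b} → a ≈ b → a ⁻¹ ≈ b ⁻¹
    ⁻¹-inverse : ∀ a → ¬ (a ≈ 0#) → a * a ⁻¹ ≈ 1#
    0≉1       : ¬ (0# ≈ 1#)
    char0     : ∀ n → ¬ (ι commRing (suc n) ≈ 0#)
  open CommutativeRing commRing public

module FieldDefs {c ℓ} (F : Char0Field c ℓ) where
  open Char0Field F hiding (zero)

  ιF : ℕ → Carrier
  ιF = ι commRing

  pow : Carrier → ℕ → Carrier
  pow a zero    = 1#
  pow a (suc n) = pow a n * a

  fall : Carrier → ℕ → Carrier → Carrier
  fall x zero    lam = 1#
  fall x (suc n) lam = fall x n lam * (x - ιF n * lam)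

  sumTo : ℕ → (ℕ → Carrier) → Carrier
  sumTo zero    f = 0#
  sumTo (suc n) f = sumTo n f + f n

  Series : Set c
  Series = ℕ → Carrier

  _·_ : Series → Series → Series
  (a · b) n = sumTo (suc n) (λ k → a k * b (n ℕ.∸ k))

  powS : Series → ℕ → Series
  powS a zero    = λ { zero → 1# ; (suc _) → 0# }
  powS a (suc n) = powS a n · a

  oneMinusX : Series
  oneMinusX zero          = 1#
  oneMinusX (suc zero)    = - 1#
  oneMinusX (suc (suc _)) = 0#

  -- multiplicative inverse of a series a (meaningful when a 0 ≉ 0):
  -- b 0 = (a 0)⁻¹,  b m = - (a 0)⁻¹ * Σ_{k=1}^{m} a k * b (m - k).
  -- invVec a n = [b n, b (n-1), ..., b 0]
  invVec : Series → (n : ℕ) → Vec Carrier (suc n)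
  invVec a zero    = (a 0 ⁻¹) ∷ []
  invVec a (suc n) =
    (- (a 0 ⁻¹) * Vec.foldr _ _+_ 0#
        (Vec.zipWith _*_ (Vec.tabulate (λ (i : Fin (suc n)) → a (suc (toℕ i))))
                         (invVec a n)))
    ∷ invVec a n

  invS : Series → Series
  invS a n = Vec.head (invVec a n)

  polyCoeff : List Carrier → Series
  polyCoeff []       k       = 0#
  polyCoeff (c ∷ cs) zero    = c
  polyCoeff (c ∷ cs) (suc k) = polyCoeff cs k

  evalPoly : List Carrier → Carrier → Carrier
  evalPoly []       x = 0#
  evalPoly (c ∷ cs) x = c + x * evalPoly cs x

  degSeries : Carrier → ℕ → Series
  degSeries lam n j = fall (ιF (suc j)) n lam

  IsDegEulerian : Carrier → (ℕ → List Carrier) → Set ℓ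
  IsDegEulerian lam A =
    ∀ n i → polyCoeff (A n) i ≈ (powS oneMinusX (suc n) · degSeries lam n) i

  degExpS : Carrier → Carrier → Series
  degExpS mu c k = fall 1# k mu * pow c k * (ιF (k ℕ.!)) ⁻¹

  denomS : Carrier → Carrier → Series
  denomS lam x zero    = x - degExpS (- lam) (x - 1#) 0
  denomS lam x (suc k) = - degExpS (- lam) (x - 1#) (suc k)

  lhsS : Carrier → Carrier → Series
  lhsS lam x n = (x - 1#) * invS (denomS lam x) n

-- Write s_n(j) = (j+1)_{n,λ}/n! and e_n = A_{n,λ}(x)/n!. By definition the coefficient sequence
-- of A_{n,λ}(X)/n! is Δ^{n+1} s_n, where Δ is multiplication by 1 - X. The degenerate
-- Vandermonde identity (a + b)_{n,λ}/n! = Σ_k (a)_{k,λ}/k! (b)_{n-k,λ}/(n-k)! with a = j + 1 and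
-- b = -1 says that Σ_k s_k (-1)_{n-k,λ}/(n-k)! is s_n shifted by one place when n ≥ 1. Applying
-- Δ^{n+1} and evaluating at X = x gives Σ_k e_k (1-x)^{n-k} (-1)_{n-k,λ}/(n-k)! = x e_n, and
-- (1-x)^k (-1)_{k,λ} = (x-1)^k (1)_{k,-λ}, so (x - e_{-λ}((x-1)t)) Σ_n e_n t^n = x - 1.
module Submission where

open import Defs
open import Data.List using (List)
open import Data.Nat using (ℕ; _!)
open import Relation.Nullary using (¬_)

open import Algebra.Bundles using (CommutativeRing)
import Algebra.Solver.Ring
open import Algebra.Solver.Ring.AlmostCommutativeRing using (fromCommutativeRing; _-Raw-AlmostCommutative⟶_)
open import Data.Fin using (Fin; toℕ)
open import Data.Integer as ℤ using (ℤ; +_; -[1+_])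
import Data.Integer.Properties as ℤ
open import Data.List as List using ([]; _∷_)
open import Data.Maybe using (Maybe; just; nothing)
open import Data.Nat as ℕ using (suc; zero)
open import Data.Nat.GeneralisedArithmetic using (fold; fold-+)
import Data.Nat.Properties as ℕ
open import Data.Vec as Vec using (Vec; []; _∷_)
open import Data.Vec.Relation.Binary.Pointwise.Inductive as Pointwise using (Pointwise; []; _∷_)
open import Relation.Binary.PropositionalEquality as ≡ using (_≡_)
open import Relation.Nullary using (yes; no)

module RingSolver {c ℓ} (R : CommutativeRing c ℓ) where
  open CommutativeRing R
  open import Algebra.Properties.Ring ring using (-‿involutive; -0#≈0#; -‿distribˡ-*)
  open import Algebra.Properties.AbelianGroup +-abelianGroup using (⁻¹-∙-comm)
  open import Algebra.Properties.CommutativeSemigroup +-commutativeSemigroup using (interchange; x∙yz≈y∙xz)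
  open import Algebra.Properties.Semiring.Mult semiring using (_×_; ×-homo-+; ×1-homo-*)
  open import Relation.Binary.Reasoning.Setoid setoid

  ι≡×1# : ∀ n → ι R n ≡ n × 1#
  ι≡×1# zero    = ≡.refl
  ι≡×1# (suc n) = ≡.cong (_+_ 1#) (ι≡×1# n)

  ι-+ : ∀ m n → ι R (m ℕ.+ n) ≈ ι R m + ι R n
  ι-+ m n rewrite ι≡×1# (m ℕ.+ n) | ι≡×1# m | ι≡×1# n = ×-homo-+ 1# m n

  ι-* : ∀ m n → ι R (m ℕ.* n) ≈ ι R m * ι R n
  ι-* m n rewrite ι≡×1# (m ℕ.* n) | ι≡×1# m | ι≡×1# n = ×1-homo-* m n

  ι-∸ : ∀ {k m} → k ℕ.≤ m → ι R m ≈ ι R k + ι R (m ℕ.∸ k)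
  ι-∸ {k} {m} k≤m = trans (reflexive (≡.cong (ι R) (≡.sym (ℕ.m+[n∸m]≡n k≤m)))) (ι-+ k (m ℕ.∸ k))

  ⟦_⟧ℤ : ℤ → Carrier
  ⟦ + n      ⟧ℤ = ι R n
  ⟦ -[1+ n ] ⟧ℤ = - ι R (suc n)

  ⟦⊖⟧ : ∀ m n → ⟦ m ℤ.⊖ n ⟧ℤ ≈ ι R m - ι R n
  ⟦⊖⟧ m       zero    = sym (trans (+-congˡ -0#≈0#) (+-identityʳ _))
  ⟦⊖⟧ zero    (suc n) = sym (+-identityˡ _)
  ⟦⊖⟧ (suc m) (suc n) = begin
    ⟦ suc m ℤ.⊖ suc n ⟧ℤ             ≡⟨ ≡.cong ⟦_⟧ℤ (ℤ.[1+m]⊖[1+n]≡m⊖n m n) ⟩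
    ⟦ m ℤ.⊖ n ⟧ℤ                     ≈⟨ ⟦⊖⟧ m n ⟩
    ι R m - ι R n                    ≈⟨ sym (+-identityˡ _) ⟩
    0# + (ι R m - ι R n)             ≈⟨ +-congʳ (sym (-‿inverseʳ 1#)) ⟩
    (1# - 1#) + (ι R m - ι R n)      ≈⟨ interchange _ _ _ _ ⟩
    (1# + ι R m) + (- 1# - ι R n)    ≈⟨ +-congˡ (⁻¹-∙-comm _ _) ⟩
    (1# + ι R m) - (1# + ι R n)      ∎

  ⟦⟧-+ : ∀ i j → ⟦ i ℤ.+ j ⟧ℤ ≈ ⟦ i ⟧ℤ + ⟦ j ⟧ℤ
  ⟦⟧-+ -[1+ m ] -[1+ n ] = begin
    - (1# + ι R (suc m ℕ.+ n))     ≈⟨ -‿cong (+-congˡ (ι-+ (suc m) n)) ⟩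
    - (1# + (ι R (suc m) + ι R n)) ≈⟨ -‿cong (x∙yz≈y∙xz _ _ _) ⟩
    - (ι R (suc m) + ι R (suc n))  ≈⟨ ⁻¹-∙-comm _ _ ⟨
    - ι R (suc m) - ι R (suc n)    ∎
  ⟦⟧-+ -[1+ m ] (+ n)    = trans (⟦⊖⟧ n (suc m)) (+-comm _ _)
  ⟦⟧-+ (+ m)    -[1+ n ] = ⟦⊖⟧ m (suc n)
  ⟦⟧-+ (+ m)    (+ n)    = ι-+ m n

  ⟦⟧-neg : ∀ i → ⟦ ℤ.- i ⟧ℤ ≈ - ⟦ i ⟧ℤ
  ⟦⟧-neg -[1+ n ]    = sym (-‿involutive _)
  ⟦⟧-neg (+ zero)    = sym -0#≈0#
  ⟦⟧-neg (+ (suc n)) = refl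

  ⟦+⟧-* : ∀ m j → ⟦ + m ℤ.* j ⟧ℤ ≈ ι R m * ⟦ j ⟧ℤ
  ⟦+⟧-* zero    j = sym (zeroˡ _)
  ⟦+⟧-* (suc m) j = begin
    ⟦ + suc m ℤ.* j ⟧ℤ           ≡⟨ ≡.cong ⟦_⟧ℤ (ℤ.suc-* (+ m) j) ⟩
    ⟦ j ℤ.+ + m ℤ.* j ⟧ℤ         ≈⟨ ⟦⟧-+ j (+ m ℤ.* j) ⟩
    ⟦ j ⟧ℤ + ⟦ + m ℤ.* j ⟧ℤ      ≈⟨ +-cong (sym (*-identityˡ _)) (⟦+⟧-* m j) ⟩
    1# * ⟦ j ⟧ℤ + ι R m * ⟦ j ⟧ℤ ≈⟨ distribʳ _ _ _ ⟨
    ι R (suc m) * ⟦ j ⟧ℤ         ∎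

  ⟦⟧-* : ∀ i j → ⟦ i ℤ.* j ⟧ℤ ≈ ⟦ i ⟧ℤ * ⟦ j ⟧ℤ
  ⟦⟧-* (+ m)    j = ⟦+⟧-* m j
  ⟦⟧-* -[1+ m ] j = begin
    ⟦ -[1+ m ] ℤ.* j ⟧ℤ          ≡⟨ ≡.cong ⟦_⟧ℤ (ℤ.neg-distribˡ-* (+ suc m) j) ⟨
    ⟦ ℤ.- (+ suc m ℤ.* j) ⟧ℤ     ≈⟨ ⟦⟧-neg (+ suc m ℤ.* j) ⟩
    - ⟦ + suc m ℤ.* j ⟧ℤ         ≈⟨ -‿cong (⟦+⟧-* (suc m) j) ⟩
    - (ι R (suc m) * ⟦ j ⟧ℤ)     ≈⟨ -‿distribˡ-* _ _ ⟩
    - ι R (suc m) * ⟦ j ⟧ℤ       ∎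

  -- The normaliser cancels terms only when it can decide equality of their coefficients,
  -- so the coefficients are integers, mapped into R through ι.
  private
    R′ = fromCommutativeRing R

    embedding : ℤ.+-*-rawRing -Raw-AlmostCommutative⟶ R′
    embedding = record
      { ⟦_⟧    = ⟦_⟧ℤ
      ; +-homo = ⟦⟧-+
      ; *-homo = ⟦⟧-*
      ; -‿homo = ⟦⟧-neg
      ; 0-homo = refl
      ; 1-homo = +-identityʳ 1#
      }

    _≟ℤ_ : ∀ i j → Maybe (⟦ i ⟧ℤ ≈ ⟦ j ⟧ℤ)
    i ≟ℤ j with i ℤ.≟ j
    ... | yes ≡.refl = just refl
    ... | no _       = nothing

  open Algebra.Solver.Ring ℤ.+-*-rawRing R′ embedding _≟ℤ_ public
    using (solve; _:=_; _:+_; _:*_; :-_; _:-_)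

module _ {c ℓ} (F : Char0Field c ℓ) where
  open Char0Field F hiding (zero)
  open FieldDefs F
  open RingSolver commRing
  open import Algebra.Properties.Ring ring using (-0#≈0#; -‿distribˡ-*; -‿distribʳ-*; -1*x≈-x; [y-z]x≈yx-zx)
  open import Algebra.Properties.AbelianGroup +-abelianGroup using (⁻¹-∙-comm)
  open import Algebra.Properties.Group +-group using (inverseˡ-unique; x∙y⁻¹≈ε⇒x≈y)
  open import Algebra.Properties.CommutativeSemigroup +-commutativeSemigroup using () renaming (interchange to +-interchange)
  open import Algebra.Properties.CommutativeSemigroup *-commutativeSemigroup
    using (x∙yz≈y∙xz; x∙yz≈yx∙z; xy∙z≈y∙xz; xy∙z≈xz∙y) renaming (interchange to *-interchange)
  open import Relation.Binary.Reasoning.Setoid setoid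

  module FieldProperties where

    *-cancelˡ : ∀ {u p q} → ¬ (u ≈ 0#) → u * p ≈ u * q → p ≈ q
    *-cancelˡ {u} {p} {q} u≉0 up≈uq = begin
      p                 ≈⟨ *-identityˡ p ⟨
      1# * p            ≈⟨ *-congʳ u⁻¹u≈1 ⟨
      (u ⁻¹ * u) * p    ≈⟨ *-assoc _ _ _ ⟩
      u ⁻¹ * (u * p)    ≈⟨ *-congˡ up≈uq ⟩
      u ⁻¹ * (u * q)    ≈⟨ *-assoc _ _ _ ⟨
      (u ⁻¹ * u) * q    ≈⟨ *-congʳ u⁻¹u≈1 ⟩
      1# * q            ≈⟨ *-identityˡ q ⟩
      q                 ∎
      where u⁻¹u≈1 = trans (*-comm _ _) (⁻¹-inverse u u≉0)

    ⁻¹-unique : ∀ {u y} → u * y ≈ 1# → y ≈ u ⁻¹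
    ⁻¹-unique {u} uy≈1 = *-cancelˡ u≉0 (trans uy≈1 (sym (⁻¹-inverse u u≉0)))
      where
      u≉0 : ¬ (u ≈ 0#)
      u≉0 u≈0 = 0≉1 (trans (sym (trans (*-congʳ u≈0) (zeroˡ _))) uy≈1)

    *-solveˡ : ∀ {u y z} → ¬ (u ≈ 0#) → u * y + z ≈ 0# → y ≈ - (u ⁻¹) * z
    *-solveˡ {u} {y} {z} u≉0 uy+z≈0 = *-cancelˡ u≉0 (begin
      u * y                 ≈⟨ inverseˡ-unique _ _ uy+z≈0 ⟩
      - z                   ≈⟨ -1*x≈-x z ⟨
      - 1# * z              ≈⟨ *-congʳ (-‿cong (⁻¹-inverse u u≉0)) ⟨
      - (u * u ⁻¹) * z      ≈⟨ solve 3 (λ u v z → :- (u :* v) :* z := u :* (:- v :* z)) refl u (u ⁻¹) z ⟩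
      u * (- (u ⁻¹) * z)    ∎)

    ι-nonZero : ∀ n → .{{ℕ.NonZero n}} → ¬ (ιF n ≈ 0#)
    ι-nonZero (suc n) = char0 n

    ι1⁻¹≈1 : ιF 1 ⁻¹ ≈ 1#
    ι1⁻¹≈1 = sym (⁻¹-unique (trans (*-identityʳ _) (+-identityʳ 1#)))

  module FiniteSums where

    sumTo-cong< : ∀ n {f g : ℕ → Carrier} → (∀ i → i ℕ.< n → f i ≈ g i) → sumTo n f ≈ sumTo n g
    sumTo-cong< zero    f≈g = refl
    sumTo-cong< (suc n) f≈g = +-cong (sumTo-cong< n (λ i i<n → f≈g i (ℕ.m<n⇒m<1+n i<n))) (f≈g n ℕ.≤-refl)

    sumTo-cong : ∀ n {f g : ℕ → Carrier} → (∀ i → f i ≈ g i) → sumTo n f ≈ sumTo n g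
    sumTo-cong n f≈g = sumTo-cong< n (λ i _ → f≈g i)

    sumTo-zero : ∀ n {f : ℕ → Carrier} → (∀ i → f i ≈ 0#) → sumTo n f ≈ 0#
    sumTo-zero zero    f≈0 = refl
    sumTo-zero (suc n) f≈0 = trans (+-cong (sumTo-zero n f≈0) (f≈0 n)) (+-identityʳ 0#)

    sumTo-+ : ∀ n (f g : ℕ → Carrier) → sumTo n (λ i → f i + g i) ≈ sumTo n f + sumTo n g
    sumTo-+ zero    f g = sym (+-identityˡ 0#)
    sumTo-+ (suc n) f g = trans (+-congʳ (sumTo-+ n f g)) (+-interchange _ _ _ _)

    sumTo-neg : ∀ n (f : ℕ → Carrier) → sumTo n (λ i → - f i) ≈ - sumTo n f
    sumTo-neg zero    f = sym -0#≈0#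
    sumTo-neg (suc n) f = trans (+-congʳ (sumTo-neg n f)) (⁻¹-∙-comm _ _)

    sumTo-- : ∀ n (f g : ℕ → Carrier) → sumTo n (λ i → f i - g i) ≈ sumTo n f - sumTo n g
    sumTo-- n f g = trans (sumTo-+ n f (λ i → - g i)) (+-congˡ (sumTo-neg n g))

    sumTo-*ˡ : ∀ n a (f : ℕ → Carrier) → sumTo n (λ i → a * f i) ≈ a * sumTo n f
    sumTo-*ˡ zero    a f = sym (zeroʳ a)
    sumTo-*ˡ (suc n) a f = trans (+-congʳ (sumTo-*ˡ n a f)) (sym (distribˡ _ _ _))

    sumTo-*ʳ : ∀ n a (f : ℕ → Carrier) → sumTo n (λ i → f i * a) ≈ sumTo n f * a
    sumTo-*ʳ zero    a f = sym (zeroˡ a)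
    sumTo-*ʳ (suc n) a f = trans (+-congʳ (sumTo-*ʳ n a f)) (sym (distribʳ _ _ _))

    sumTo-head : ∀ n (f : ℕ → Carrier) → sumTo (suc n) f ≈ f 0 + sumTo n (λ i → f (suc i))
    sumTo-head zero    f = trans (+-identityˡ _) (sym (+-identityʳ _))
    sumTo-head (suc n) f = trans (+-congʳ (sumTo-head n f)) (+-assoc _ _ _)

    sumTo-head-zero : ∀ n {f : ℕ → Carrier} → f 0 ≈ 0# → sumTo (suc n) f ≈ sumTo n (λ i → f (suc i))
    sumTo-head-zero n f₀≈0 = trans (sumTo-head n _) (trans (+-congʳ f₀≈0) (+-identityˡ _))

    sumTo-last-zero : ∀ n {f : ℕ → Carrier} → f n ≈ 0# → sumTo (suc n) f ≈ sumTo n f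
    sumTo-last-zero n fₙ≈0 = trans (+-congˡ fₙ≈0) (+-identityʳ _)

    sumTo-reverse : ∀ n (f : ℕ → Carrier) → sumTo (suc n) f ≈ sumTo (suc n) (λ k → f (n ℕ.∸ k))
    sumTo-reverse zero    f = refl
    sumTo-reverse (suc n) f = begin
      sumTo (suc n) f + f (suc n)                     ≈⟨ +-congʳ (sumTo-reverse n f) ⟩
      sumTo (suc n) (λ k → f (n ℕ.∸ k)) + f (suc n)   ≈⟨ +-comm _ _ ⟩
      f (suc n) + sumTo (suc n) (λ k → f (n ℕ.∸ k))   ≈⟨ sumTo-head (suc n) (λ k → f (suc n ℕ.∸ k)) ⟨
      sumTo (suc (suc n)) (λ k → f (suc n ℕ.∸ k))     ∎

  module PowerSeries where
    open FiniteSums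

    infix 4 _≋_
    _≋_ : Series → Series → Set ℓ
    f ≋ g = ∀ j → f j ≈ g j

    sh : Series → Series
    sh f zero    = 0#
    sh f (suc j) = f j

    Δ : Series → Series
    Δ f zero    = f zero
    Δ f (suc j) = f (suc j) - f j

    iterΔ : ℕ → Series → Series
    iterΔ n f = fold f Δ n

    ·-congˡ : ∀ {a b} g → a ≋ b → (a · g) ≋ (b · g)
    ·-congˡ g a≋b n = sumTo-cong (suc n) (λ k → *-congʳ (a≋b k))

    ·-comm : ∀ a b → (a · b) ≋ (b · a)
    ·-comm a b n = begin
      sumTo (suc n) (λ k → a k * b (n ℕ.∸ k))                     ≈⟨ sumTo-reverse n _ ⟩
      sumTo (suc n) (λ k → a (n ℕ.∸ k) * b (n ℕ.∸ (n ℕ.∸ k)))     ≈⟨ sumTo-cong< (suc n) swap ⟩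
      sumTo (suc n) (λ k → b k * a (n ℕ.∸ k))                     ∎
      where
      swap : ∀ k → k ℕ.< suc n → a (n ℕ.∸ k) * b (n ℕ.∸ (n ℕ.∸ k)) ≈ b k * a (n ℕ.∸ k)
      swap k k<1+n rewrite ℕ.m∸[m∸n]≡n (ℕ.s≤s⁻¹ k<1+n) = *-comm _ _

    ·-*ʳ : ∀ a b c n → (a · (λ j → b j * c)) n ≈ (a · b) n * c
    ·-*ʳ a b c n = trans (sumTo-cong (suc n) (λ k → sym (*-assoc _ _ _))) (sumTo-*ʳ (suc n) c _)

    powS-zero-· : ∀ a g → (powS a 0 · g) ≋ g
    powS-zero-· a g n = begin
      (powS a 0 · g) n                                    ≈⟨ sumTo-head n _ ⟩
      1# * g n + sumTo n (λ i → 0# * g (n ℕ.∸ suc i))     ≈⟨ +-cong (*-identityˡ _) (sumTo-zero n (λ i → zeroˡ _)) ⟩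
      g n + 0#                                            ≈⟨ +-identityʳ _ ⟩
      g n                                                 ∎

    oneMinusX-· : ∀ g → (oneMinusX · g) ≋ Δ g
    oneMinusX-· g zero    = trans (+-identityˡ _) (*-identityˡ _)
    oneMinusX-· g (suc n) = begin
      (oneMinusX · g) (suc n)                                                 ≈⟨ sumTo-head (suc n) _ ⟩
      1# * g (suc n) + sumTo (suc n) (λ i → oneMinusX (suc i) * g (n ℕ.∸ i))  ≈⟨ +-congˡ (sumTo-head n _) ⟩
      1# * g (suc n) + (- 1# * g n + sumTo n (λ i → 0# * g (n ℕ.∸ suc i)))   ≈⟨ +-cong (*-identityˡ _) (+-cong (-1*x≈-x _) (sumTo-zero n (λ i → zeroˡ _))) ⟩
      g (suc n) + (- g n + 0#)                                                ≈⟨ +-congˡ (+-identityʳ _) ⟩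
      g (suc n) - g n                                                         ∎

    Δ-· : ∀ a g → (Δ a · g) ≋ Δ (a · g)
    Δ-· a g zero    = refl
    Δ-· a g (suc n) = begin
      (Δ a · g) (suc n)                                                        ≈⟨ sumTo-head (suc n) _ ⟩
      a 0 * g (suc n) + sumTo (suc n) (λ i → (a (suc i) - a i) * g (n ℕ.∸ i))
        ≈⟨ +-congˡ (trans (sumTo-cong (suc n) (λ i → [y-z]x≈yx-zx _ _ _)) (sumTo-- (suc n) _ _)) ⟩
      a 0 * g (suc n) + (sumTo (suc n) (λ i → a (suc i) * g (n ℕ.∸ i)) - (a · g) n) ≈⟨ +-assoc _ _ _ ⟨
      (a 0 * g (suc n) + sumTo (suc n) (λ i → a (suc i) * g (n ℕ.∸ i))) - (a · g) n ≈⟨ +-congʳ (sumTo-head (suc n) _) ⟨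
      Δ (a · g) (suc n)                                                        ∎

    Δ-cong : ∀ {f g} → f ≋ g → Δ f ≋ Δ g
    Δ-cong f≋g zero    = f≋g zero
    Δ-cong f≋g (suc j) = +-cong (f≋g (suc j)) (-‿cong (f≋g j))

    iterΔ-cong : ∀ n {f g} → f ≋ g → iterΔ n f ≋ iterΔ n g
    iterΔ-cong zero    f≋g = f≋g
    iterΔ-cong (suc n) f≋g = Δ-cong (iterΔ-cong n f≋g)

    powS-oneMinusX-· : ∀ n g → (powS oneMinusX n · g) ≋ iterΔ n g
    powS-oneMinusX-· zero    g = powS-zero-· oneMinusX g
    powS-oneMinusX-· (suc n) g j = begin
      ((powS oneMinusX n · oneMinusX) · g) j   ≈⟨ ·-congˡ g (·-comm _ _) j ⟩
      ((oneMinusX · powS oneMinusX n) · g) j   ≈⟨ ·-congˡ g (oneMinusX-· _) j ⟩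
      (Δ (powS oneMinusX n) · g) j             ≈⟨ Δ-· _ g j ⟩
      Δ (powS oneMinusX n · g) j               ≈⟨ Δ-cong (powS-oneMinusX-· n g) j ⟩
      iterΔ (suc n) g j                        ∎

    sh-cong : ∀ {f g} → f ≋ g → sh f ≋ sh g
    sh-cong f≋g zero    = refl
    sh-cong f≋g (suc j) = f≋g j

    Δ-sh : ∀ f → Δ (sh f) ≋ sh (Δ f)
    Δ-sh f zero          = refl
    Δ-sh f (suc zero)    = trans (+-congˡ -0#≈0#) (+-identityʳ _)
    Δ-sh f (suc (suc j)) = refl

    iterΔ-sh : ∀ n f → iterΔ n (sh f) ≋ sh (iterΔ n f)
    iterΔ-sh zero    f j = refl
    iterΔ-sh (suc n) f j = trans (Δ-cong (iterΔ-sh n f) j) (Δ-sh (iterΔ n f) j)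

    Δ-*ʳ : ∀ f a → Δ (λ j → f j * a) ≋ (λ j → Δ f j * a)
    Δ-*ʳ f a zero    = refl
    Δ-*ʳ f a (suc j) = sym ([y-z]x≈yx-zx _ _ _)

    iterΔ-*ʳ : ∀ n f a → iterΔ n (λ j → f j * a) ≋ (λ j → iterΔ n f j * a)
    iterΔ-*ʳ zero    f a j = refl
    iterΔ-*ʳ (suc n) f a j = trans (Δ-cong (iterΔ-*ʳ n f a) j) (Δ-*ʳ (iterΔ n f) a j)

    Δ-sumTo : ∀ m (h : ℕ → Series) → Δ (λ j → sumTo m (λ k → h k j)) ≋ (λ j → sumTo m (λ k → Δ (h k) j))
    Δ-sumTo m h zero    = refl
    Δ-sumTo m h (suc j) = sym (sumTo-- m _ _)

    iterΔ-sumTo : ∀ n m (h : ℕ → Series) →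
                  iterΔ n (λ j → sumTo m (λ k → h k j)) ≋ (λ j → sumTo m (λ k → iterΔ n (h k) j))
    iterΔ-sumTo zero    m h j = refl
    iterΔ-sumTo (suc n) m h j = trans (Δ-cong (iterΔ-sumTo n m h) j) (Δ-sumTo m (λ k → iterΔ n (h k)) j)

  module Polynomials where
    open PowerSeries

    infixl 6 _⊕_
    _⊕_ : List Carrier → List Carrier → List Carrier
    []      ⊕ q       = q
    (a ∷ p) ⊕ []      = a ∷ p
    (a ∷ p) ⊕ (b ∷ q) = a + b ∷ p ⊕ q

    Δₚ : List Carrier → List Carrier
    Δₚ p = p ⊕ (0# ∷ List.map -_ p)

    iterΔₚ : ℕ → List Carrier → List Carrier
    iterΔₚ n p = fold p Δₚ n

    sumₚ : ℕ → (ℕ → List Carrier) → List Carrier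
    sumₚ zero    P = []
    sumₚ (suc n) P = sumₚ n P ⊕ P n

    polyCoeff-⊕ : ∀ p q i → polyCoeff (p ⊕ q) i ≈ polyCoeff p i + polyCoeff q i
    polyCoeff-⊕ []      q       i       = sym (+-identityˡ _)
    polyCoeff-⊕ (a ∷ p) []      i       = sym (+-identityʳ _)
    polyCoeff-⊕ (a ∷ p) (b ∷ q) zero    = refl
    polyCoeff-⊕ (a ∷ p) (b ∷ q) (suc i) = polyCoeff-⊕ p q i

    polyCoeff-map : ∀ f → f 0# ≈ 0# → ∀ p i → polyCoeff (List.map f p) i ≈ f (polyCoeff p i)
    polyCoeff-map f f0≈0 []      i       = sym f0≈0
    polyCoeff-map f f0≈0 (a ∷ p) zero    = refl
    polyCoeff-map f f0≈0 (a ∷ p) (suc i) = polyCoeff-map f f0≈0 p i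

    polyCoeff-shift : ∀ p → polyCoeff (0# ∷ p) ≋ sh (polyCoeff p)
    polyCoeff-shift p zero    = refl
    polyCoeff-shift p (suc i) = refl

    polyCoeff-Δₚ : ∀ p → polyCoeff (Δₚ p) ≋ Δ (polyCoeff p)
    polyCoeff-Δₚ p zero    = trans (polyCoeff-⊕ p _ zero) (+-identityʳ _)
    polyCoeff-Δₚ p (suc i) = trans (polyCoeff-⊕ p _ (suc i)) (+-congˡ (polyCoeff-map -_ -0#≈0# p i))

    polyCoeff-iterΔₚ : ∀ n p → polyCoeff (iterΔₚ n p) ≋ iterΔ n (polyCoeff p)
    polyCoeff-iterΔₚ zero    p i = refl
    polyCoeff-iterΔₚ (suc n) p i = trans (polyCoeff-Δₚ (iterΔₚ n p) i) (Δ-cong (polyCoeff-iterΔₚ n p) i)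

    polyCoeff-sumₚ : ∀ n P i → polyCoeff (sumₚ n P) i ≈ sumTo n (λ k → polyCoeff (P k) i)
    polyCoeff-sumₚ zero    P i = refl
    polyCoeff-sumₚ (suc n) P i = trans (polyCoeff-⊕ (sumₚ n P) (P n) i) (+-congʳ (polyCoeff-sumₚ n P i))

  module PolynomialEvaluation (x : Carrier) where
    open PowerSeries using (_≋_)
    open Polynomials

    evalPoly-⊕ : ∀ p q → evalPoly (p ⊕ q) x ≈ evalPoly p x + evalPoly q x
    evalPoly-⊕ []      q       = sym (+-identityˡ _)
    evalPoly-⊕ (a ∷ p) []      = sym (+-identityʳ _)
    evalPoly-⊕ (a ∷ p) (b ∷ q) = begin
      (a + b) + x * evalPoly (p ⊕ q) x                     ≈⟨ +-congˡ (*-congˡ (evalPoly-⊕ p q)) ⟩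
      (a + b) + x * (evalPoly p x + evalPoly q x)          ≈⟨ solve 5 (λ a b y P Q → (a :+ b) :+ y :* (P :+ Q) := (a :+ y :* P) :+ (b :+ y :* Q)) refl a b x _ _ ⟩
      (a + x * evalPoly p x) + (b + x * evalPoly q x)      ∎

    evalPoly-map-* : ∀ p c → evalPoly (List.map (_* c) p) x ≈ evalPoly p x * c
    evalPoly-map-* []      c = sym (zeroˡ c)
    evalPoly-map-* (a ∷ p) c = begin
      a * c + x * evalPoly (List.map (_* c) p) x   ≈⟨ +-congˡ (*-congˡ (evalPoly-map-* p c)) ⟩
      a * c + x * (evalPoly p x * c)               ≈⟨ solve 4 (λ a c y P → a :* c :+ y :* (P :* c) := (a :+ y :* P) :* c) refl a c x _ ⟩
      (a + x * evalPoly p x) * c                   ∎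

    evalPoly-Δₚ : ∀ p → evalPoly (Δₚ p) x ≈ (1# - x) * evalPoly p x
    evalPoly-Δₚ p = begin
      evalPoly (p ⊕ (0# ∷ List.map -_ p)) x                 ≈⟨ evalPoly-⊕ p _ ⟩
      evalPoly p x + (0# + x * evalPoly (List.map -_ p) x)  ≈⟨ +-congˡ (+-congˡ (*-congˡ (evalPoly-neg p))) ⟩
      evalPoly p x + (0# + x * - evalPoly p x)              ≈⟨ +-cong (sym (*-identityˡ _)) (trans (+-identityˡ _) (sym (-‿distribʳ-* _ _))) ⟩
      1# * evalPoly p x - x * evalPoly p x                  ≈⟨ [y-z]x≈yx-zx _ _ _ ⟨
      (1# - x) * evalPoly p x                               ∎
      where
      evalPoly-neg : ∀ p → evalPoly (List.map -_ p) x ≈ - evalPoly p x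
      evalPoly-neg []      = sym -0#≈0#
      evalPoly-neg (a ∷ p) = begin
        - a + x * evalPoly (List.map -_ p) x   ≈⟨ +-congˡ (*-congˡ (evalPoly-neg p)) ⟩
        - a + x * - evalPoly p x               ≈⟨ solve 3 (λ a y P → :- a :+ y :* (:- P) := :- (a :+ y :* P)) refl a x _ ⟩
        - (a + x * evalPoly p x)               ∎

    evalPoly-iterΔₚ : ∀ n p → evalPoly (iterΔₚ n p) x ≈ pow (1# - x) n * evalPoly p x
    evalPoly-iterΔₚ zero    p = sym (*-identityˡ _)
    evalPoly-iterΔₚ (suc n) p = begin
      evalPoly (Δₚ (iterΔₚ n p)) x                   ≈⟨ evalPoly-Δₚ (iterΔₚ n p) ⟩
      (1# - x) * evalPoly (iterΔₚ n p) x             ≈⟨ *-congˡ (evalPoly-iterΔₚ n p) ⟩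
      (1# - x) * (pow (1# - x) n * evalPoly p x)     ≈⟨ x∙yz≈yx∙z _ _ _ ⟩
      pow (1# - x) (suc n) * evalPoly p x            ∎

    evalPoly-sumₚ : ∀ n P → evalPoly (sumₚ n P) x ≈ sumTo n (λ k → evalPoly (P k) x)
    evalPoly-sumₚ zero    P = refl
    evalPoly-sumₚ (suc n) P = trans (evalPoly-⊕ (sumₚ n P) (P n)) (+-congʳ (evalPoly-sumₚ n P))

    evalPoly-zero : ∀ p → (∀ i → polyCoeff p i ≈ 0#) → evalPoly p x ≈ 0#
    evalPoly-zero []      p≈0 = refl
    evalPoly-zero (a ∷ p) p≈0 = begin
      a + x * evalPoly p x   ≈⟨ +-cong (p≈0 zero) (*-congˡ (evalPoly-zero p (λ i → p≈0 (suc i)))) ⟩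
      0# + x * 0#            ≈⟨ trans (+-identityˡ _) (zeroʳ x) ⟩
      0#                     ∎

    evalPoly-cong : ∀ p q → polyCoeff p ≋ polyCoeff q → evalPoly p x ≈ evalPoly q x
    evalPoly-cong []      q       p≋q = sym (evalPoly-zero q (λ i → sym (p≋q i)))
    evalPoly-cong (a ∷ p) []      p≋q = evalPoly-zero (a ∷ p) p≋q
    evalPoly-cong (a ∷ p) (b ∷ q) p≋q = +-cong (p≋q zero) (*-congˡ (evalPoly-cong p q (λ i → p≋q (suc i))))

  module SeriesInverse where
    open FiniteSums
    open FieldProperties
    open PowerSeries using (·-*ʳ)

    history : Series → (n : ℕ) → Vec Carrier (suc n)
    history b zero    = b 0 ∷ []
    history b (suc n) = b (suc n) ∷ history b n

    foldr-history : ∀ b n (h : ℕ → Carrier) {v} → Pointwise _≈_ v (history b n) →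
                    Vec.foldr _ _+_ 0# (Vec.zipWith _*_ (Vec.tabulate (λ (i : Fin (suc n)) → h (toℕ i))) v)
                      ≈ sumTo (suc n) (λ i → h i * b (n ℕ.∸ i))
    foldr-history b zero    h (v≈b ∷ []) = trans (+-congʳ (*-congˡ v≈b)) (+-comm _ _)
    foldr-history b (suc n) h (v≈b ∷ vs) =
      trans (+-cong (*-congˡ v≈b) (foldr-history b n (λ i → h (suc i)) vs)) (sym (sumTo-head (suc n) _))

    module _ (a b : Series) (ab₀≈1 : (a · b) 0 ≈ 1#) (ab≈0 : ∀ n → (a · b) (suc n) ≈ 0#) where

      invVec≈history : ∀ n → Pointwise _≈_ (invVec a n) (history b n)
      invVec≈history zero    = sym (⁻¹-unique (trans (sym (+-identityˡ _)) ab₀≈1)) ∷ []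
      invVec≈history (suc n) = b₁₊ₙ≈ ∷ invVec≈history n
        where
        a₀≉0 : ¬ (a 0 ≈ 0#)
        a₀≉0 a₀≈0 = 0≉1 (trans (sym (trans (+-congˡ (trans (*-congʳ a₀≈0) (zeroˡ _))) (+-identityʳ 0#))) ab₀≈1)
        b₁₊ₙ≈ : - (a 0 ⁻¹) * Vec.foldr _ _+_ 0# (Vec.zipWith _*_ (Vec.tabulate (λ (i : Fin (suc n)) → a (suc (toℕ i)))) (invVec a n))
                ≈ b (suc n)
        b₁₊ₙ≈ = trans (*-congˡ (foldr-history b n (λ i → a (suc i)) (invVec≈history n)))
                      (sym (*-solveˡ a₀≉0 (trans (sym (sumTo-head (suc n) _)) (ab≈0 n))))

      invS-unique : ∀ n → invS a n ≈ b n
      invS-unique zero    = Pointwise.head (invVec≈history zero)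
      invS-unique (suc n) = Pointwise.head (invVec≈history (suc n))

    *-invS : ∀ a f {c} → ¬ (c ≈ 0#) → (a · f) 0 ≈ c → (∀ n → (a · f) (suc n) ≈ 0#) → ∀ n → c * invS a n ≈ f n
    *-invS a f {c} c≉0 af₀≈c af≈0 n = begin
      c * invS a n           ≈⟨ *-congˡ (invS-unique a (λ k → f k * c ⁻¹) a·f/c₀≈1 a·f/c≈0 n) ⟩
      c * (f n * c ⁻¹)       ≈⟨ x∙yz≈y∙xz _ _ _ ⟩
      f n * (c * c ⁻¹)       ≈⟨ *-congˡ (⁻¹-inverse c c≉0) ⟩
      f n * 1#               ≈⟨ *-identityʳ _ ⟩
      f n                    ∎
      where
      a·f/c₀≈1 : (a · (λ k → f k * c ⁻¹)) 0 ≈ 1#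
      a·f/c₀≈1 = trans (·-*ʳ a f _ 0) (trans (*-congʳ af₀≈c) (⁻¹-inverse c c≉0))
      a·f/c≈0 : ∀ n → (a · (λ k → f k * c ⁻¹)) (suc n) ≈ 0#
      a·f/c≈0 n = trans (·-*ʳ a f _ (suc n)) (trans (*-congʳ (af≈0 n)) (zeroˡ _))

  module DegenerateBinomial (lam : Carrier) where
    open FiniteSums
    open FieldProperties

    binomial : Carrier → ℕ → Carrier
    binomial a k = fall a k lam * ιF (k !) ⁻¹

    fall-cong : ∀ n {a b} → a ≈ b → fall a n lam ≈ fall b n lam
    fall-cong zero    a≈b = refl
    fall-cong (suc n) a≈b = *-cong (fall-cong n a≈b) (+-congʳ a≈b)

    binomial-cong : ∀ n {a b} → a ≈ b → binomial a n ≈ binomial b n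
    binomial-cong n a≈b = *-congʳ (fall-cong n a≈b)

    binomial-zero : ∀ a → binomial a 0 ≈ 1#
    binomial-zero a = trans (*-identityˡ _) ι1⁻¹≈1

    fall-0#-suc : ∀ m → fall 0# (suc m) lam ≈ 0#
    fall-0#-suc zero    = trans (*-identityˡ _) (trans (+-congˡ (trans (-‿cong (zeroˡ lam)) -0#≈0#)) (+-identityʳ 0#))
    fall-0#-suc (suc m) = trans (*-congʳ (fall-0#-suc m)) (zeroˡ _)

    binomial-0#-suc : ∀ m → binomial 0# (suc m) ≈ 0#
    binomial-0#-suc m = trans (*-congʳ (fall-0#-suc m)) (zeroˡ _)

    ι[1+m]*[1+m]!⁻¹≈m!⁻¹ : ∀ m → ιF (suc m) * ιF (suc m !) ⁻¹ ≈ ιF (m !) ⁻¹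
    ι[1+m]*[1+m]!⁻¹≈m!⁻¹ m = ⁻¹-unique (begin
      ιF (m !) * (ιF (suc m) * ιF (suc m !) ⁻¹)   ≈⟨ x∙yz≈yx∙z _ _ _ ⟩
      (ιF (suc m) * ιF (m !)) * ιF (suc m !) ⁻¹   ≈⟨ *-congʳ (ι-* (suc m) (m !)) ⟨
      ιF (suc m !) * ιF (suc m !) ⁻¹              ≈⟨ ⁻¹-inverse _ (ι-nonZero (suc m !) {{suc m ℕ.!≢0}}) ⟩
      1#                                          ∎)

    binomial-suc : ∀ m a → ιF (suc m) * binomial a (suc m) ≈ binomial a m * (a - ιF m * lam)
    binomial-suc m a = begin
      ιF (suc m) * ((fall a m lam * (a - ιF m * lam)) * ιF (suc m !) ⁻¹)   ≈⟨ x∙yz≈y∙xz _ _ _ ⟩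
      (fall a m lam * (a - ιF m * lam)) * (ιF (suc m) * ιF (suc m !) ⁻¹)   ≈⟨ *-congˡ (ι[1+m]*[1+m]!⁻¹≈m!⁻¹ m) ⟩
      (fall a m lam * (a - ιF m * lam)) * ιF (m !) ⁻¹                      ≈⟨ xy∙z≈xz∙y _ _ _ ⟩
      binomial a m * (a - ιF m * lam)                                      ∎

    fall-reflect : ∀ a y k → fall (- a) k lam * pow (- y) k ≈ fall a k (- lam) * pow y k
    fall-reflect a y zero    = refl
    fall-reflect a y (suc k) = begin
      (fall (- a) k lam * (- a - ιF k * lam)) * (pow (- y) k * - y)        ≈⟨ *-interchange _ _ _ _ ⟩
      (fall (- a) k lam * pow (- y) k) * ((- a - ιF k * lam) * - y)
        ≈⟨ *-cong (fall-reflect a y k) (solve 4 (λ a y t l → (:- a :- t :* l) :* (:- y) := (a :- t :* (:- l)) :* y) refl a y (ιF k) lam) ⟩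
      (fall a k (- lam) * pow y k) * ((a - ιF k * - lam) * y)              ≈⟨ *-interchange _ _ _ _ ⟩
      (fall a k (- lam) * (a - ιF k * - lam)) * (pow y k * y)              ∎

    module _ (a b : Carrier) where
      private
        T : ℕ → ℕ → Carrier
        T m k = binomial a k * binomial b (suc m ℕ.∸ k)

        vandermonde-step : ∀ {k m} → k ℕ.≤ m →
          binomial a k * binomial b (m ℕ.∸ k) * ((a + b) - ιF m * lam) ≈ ιF (suc k) * T m (suc k) + ιF (suc m ℕ.∸ k) * T m k
        vandermonde-step {k} {m} k≤m rewrite ℕ.+-∸-assoc 1 k≤m = begin
          A * B * ((a + b) - ιF m * lam)                       ≈⟨ *-congˡ (+-congˡ (-‿cong (*-congʳ (ι-∸ k≤m)))) ⟩
          A * B * ((a + b) - (ιF k + ιF (m ℕ.∸ k)) * lam)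
            ≈⟨ solve 7 (λ A B a b p q l → A :* B :* ((a :+ b) :- (p :+ q) :* l)
                                          := (A :* (a :- p :* l)) :* B :+ (B :* (b :- q :* l)) :* A)
                     refl A B a b (ιF k) (ιF (m ℕ.∸ k)) lam ⟩
          (A * (a - ιF k * lam)) * B + (B * (b - ιF (m ℕ.∸ k) * lam)) * A
            ≈⟨ +-cong (*-congʳ (binomial-suc k a)) (*-congʳ (binomial-suc (m ℕ.∸ k) b)) ⟨
          (ιF (suc k) * binomial a (suc k)) * B + (ιF (suc (m ℕ.∸ k)) * binomial b (suc (m ℕ.∸ k))) * A
            ≈⟨ +-cong (*-assoc _ _ _) (trans (*-assoc _ _ _) (*-congˡ (*-comm _ _))) ⟩
          ιF (suc k) * (binomial a (suc k) * B) + ιF (suc (m ℕ.∸ k)) * (A * binomial b (suc (m ℕ.∸ k))) ∎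
          where
          A = binomial a k
          B = binomial b (m ℕ.∸ k)

      -- After multiplying by m + 1 (cancellable in characteristic 0), the k-th term splits
      -- along (a + b) - mλ = (a - kλ) + (b - (m - k)λ) into the two halves of Pascal's rule.
      vandermonde : ∀ m → binomial (a + b) m ≈ sumTo (suc m) (λ k → binomial a k * binomial b (m ℕ.∸ k))
      vandermonde zero    = sym (begin
        0# + binomial a 0 * binomial b 0   ≈⟨ +-identityˡ _ ⟩
        binomial a 0 * binomial b 0        ≈⟨ *-cong (binomial-zero a) (binomial-zero b) ⟩
        1# * 1#                            ≈⟨ *-identityˡ 1# ⟩
        1#                                 ≈⟨ binomial-zero (a + b) ⟨
        binomial (a + b) 0                 ∎)
      vandermonde (suc m) = *-cancelˡ (ι-nonZero (suc m)) (begin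
        ιF (suc m) * binomial (a + b) (suc m)
          ≈⟨ binomial-suc m (a + b) ⟩
        binomial (a + b) m * γ
          ≈⟨ *-congʳ (vandermonde m) ⟩
        sumTo (suc m) (λ k → binomial a k * binomial b (m ℕ.∸ k)) * γ
          ≈⟨ sumTo-*ʳ (suc m) γ _ ⟨
        sumTo (suc m) (λ k → binomial a k * binomial b (m ℕ.∸ k) * γ)
          ≈⟨ sumTo-cong< (suc m) (λ k k<1+m → vandermonde-step (ℕ.s≤s⁻¹ k<1+m)) ⟩
        sumTo (suc m) (λ k → ιF (suc k) * T m (suc k) + ιF (suc m ℕ.∸ k) * T m k)
          ≈⟨ sumTo-+ (suc m) _ _ ⟩
        sumTo (suc m) (λ k → ιF (suc k) * T m (suc k)) + sumTo (suc m) (λ k → ιF (suc m ℕ.∸ k) * T m k)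
          ≈⟨ +-cong (sumTo-head-zero (suc m) (zeroˡ _)) (sumTo-last-zero (suc m) ι[m∸m]*T≈0) ⟨
        sumTo (suc (suc m)) (λ k → ιF k * T m k) + sumTo (suc (suc m)) (λ k → ιF (suc m ℕ.∸ k) * T m k)
          ≈⟨ sumTo-+ (suc (suc m)) _ _ ⟨
        sumTo (suc (suc m)) (λ k → ιF k * T m k + ιF (suc m ℕ.∸ k) * T m k)
          ≈⟨ sumTo-cong< (suc (suc m)) (λ k k<2+m → trans (sym (distribʳ _ _ _)) (*-congʳ (sym (ι-∸ (ℕ.s≤s⁻¹ k<2+m))))) ⟩
        sumTo (suc (suc m)) (λ k → ιF (suc m) * T m k)
          ≈⟨ sumTo-*ˡ (suc (suc m)) _ _ ⟩
        ιF (suc m) * sumTo (suc (suc m)) (T m)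
          ∎)
        where
        γ = (a + b) - ιF m * lam
        ι[m∸m]*T≈0 : ιF (m ℕ.∸ m) * T m (suc m) ≈ 0#
        ι[m∸m]*T≈0 = trans (*-congʳ (reflexive (≡.cong ιF (ℕ.n∸n≡0 m)))) (zeroˡ _)

  module DegenerateEulerian (lam : Carrier) (A : ℕ → List Carrier) (isEulerian : IsDegEulerian lam A)
                            (x : Carrier) (x≉1 : ¬ (x ≈ 1#)) where
    open FiniteSums
    open FieldProperties
    open PowerSeries
    open Polynomials
    open PolynomialEvaluation x
    open DegenerateBinomial lam

    s : ℕ → Series
    s n j = binomial (ιF (suc j)) n

    A/n! : ℕ → List Carrier
    A/n! n = List.map (_* ιF (n !) ⁻¹) (A n)

    e : Series
    e n = evalPoly (A n) x * ιF (n !) ⁻¹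

    α : Series
    α = binomial (- 1#)

    d : Series
    d = degExpS (- lam) (x - 1#)

    polyCoeff-A : ∀ n → polyCoeff (A n) ≋ iterΔ (suc n) (degSeries lam n)
    polyCoeff-A n j = trans (isEulerian n j) (powS-oneMinusX-· (suc n) _ j)

    polyCoeff-A/n! : ∀ n → polyCoeff (A/n! n) ≋ iterΔ (suc n) (s n)
    polyCoeff-A/n! n j = begin
      polyCoeff (A/n! n) j                                      ≈⟨ polyCoeff-map (_* ιF (n !) ⁻¹) (zeroˡ _) (A n) j ⟩
      polyCoeff (A n) j * ιF (n !) ⁻¹                           ≈⟨ *-congʳ (polyCoeff-A n j) ⟩
      iterΔ (suc n) (degSeries lam n) j * ιF (n !) ⁻¹           ≈⟨ iterΔ-*ʳ (suc n) _ _ j ⟨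
      iterΔ (suc n) (s n) j                                     ∎

    e₀≈1 : e 0 ≈ 1#
    e₀≈1 = begin
      evalPoly (A 0) x * ιF 1 ⁻¹   ≈⟨ *-cong (evalPoly-cong (A 0) (1# ∷ []) A₀≋1) ι1⁻¹≈1 ⟩
      (1# + x * 0#) * 1#           ≈⟨ trans (*-identityʳ _) (trans (+-congˡ (zeroʳ x)) (+-identityʳ 1#)) ⟩
      1#                           ∎
      where
      A₀≋1 : polyCoeff (A 0) ≋ polyCoeff (1# ∷ [])
      A₀≋1 zero    = polyCoeff-A 0 zero
      A₀≋1 (suc j) = trans (polyCoeff-A 0 (suc j)) (-‿inverseʳ 1#)

    d≈ : ∀ k → d k ≈ pow (1# - x) k * α k
    d≈ k = begin
      (fall 1# k (- lam) * pow (x - 1#) k) * ιF (k !) ⁻¹        ≈⟨ *-congʳ (fall-reflect 1# (x - 1#) k) ⟨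
      (fall (- 1#) k lam * pow (- (x - 1#)) k) * ιF (k !) ⁻¹    ≈⟨ *-congʳ (*-congˡ (pow-cong k (solve 2 (λ y o → :- (y :- o) := o :- y) refl x 1#))) ⟩
      (fall (- 1#) k lam * pow (1# - x) k) * ιF (k !) ⁻¹        ≈⟨ xy∙z≈y∙xz _ _ _ ⟩
      pow (1# - x) k * α k                                      ∎
      where
      pow-cong : ∀ k {a b} → a ≈ b → pow a k ≈ pow b k
      pow-cong zero    a≈b = refl
      pow-cong (suc k) a≈b = *-cong (pow-cong k a≈b) a≈b

    binomial-shift : ∀ m → (λ j → sumTo (suc (suc m)) (λ k → s k j * α (suc m ℕ.∸ k))) ≋ sh (s (suc m))
    binomial-shift m j = begin
      sumTo (suc (suc m)) (λ k → s k j * α (suc m ℕ.∸ k))  ≈⟨ vandermonde (ιF (suc j)) (- 1#) (suc m) ⟨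
      binomial (ιF (suc j) - 1#) (suc m)                   ≈⟨ binomial-cong (suc m) (solve 2 (λ t o → (o :+ t) :- o := t) refl (ιF j) 1#) ⟩
      binomial (ιF j) (suc m)                              ≈⟨ at j ⟩
      sh (s (suc m)) j                                     ∎
      where
      at : ∀ j → binomial (ιF j) (suc m) ≈ sh (s (suc m)) j
      at zero    = binomial-0#-suc m
      at (suc j) = refl

    e·d-polynomial : ℕ → List Carrier
    e·d-polynomial n = sumₚ (suc n) (λ k → List.map (_* α (n ℕ.∸ k)) (iterΔₚ (n ℕ.∸ k) (A/n! k)))

    polyCoeff-e·d-polynomial : ∀ m → polyCoeff (e·d-polynomial (suc m)) ≋ polyCoeff (0# ∷ A/n! (suc m))
    polyCoeff-e·d-polynomial m j = begin
      polyCoeff (e·d-polynomial n) j                                            ≈⟨ polyCoeff-sumₚ (suc n) _ j ⟩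
      sumTo (suc n) (λ k → polyCoeff (List.map (_* α (n ℕ.∸ k)) (iterΔₚ (n ℕ.∸ k) (A/n! k))) j)
        ≈⟨ sumTo-cong< (suc n) (λ k k<1+n → term (ℕ.s≤s⁻¹ k<1+n)) ⟩
      sumTo (suc n) (λ k → iterΔ (suc n) (λ i → s k i * α (n ℕ.∸ k)) j)         ≈⟨ iterΔ-sumTo (suc n) (suc n) _ j ⟨
      iterΔ (suc n) (λ i → sumTo (suc n) (λ k → s k i * α (n ℕ.∸ k))) j         ≈⟨ iterΔ-cong (suc n) (binomial-shift m) j ⟩
      iterΔ (suc n) (sh (s n)) j                                                ≈⟨ iterΔ-sh (suc n) (s n) j ⟩
      sh (iterΔ (suc n) (s n)) j                                                ≈⟨ sh-cong (polyCoeff-A/n! n) j ⟨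
      sh (polyCoeff (A/n! n)) j                                                 ≈⟨ polyCoeff-shift (A/n! n) j ⟨
      polyCoeff (0# ∷ A/n! n) j                                                 ∎
      where
      n = suc m
      term : ∀ {k} → k ℕ.≤ n →
             polyCoeff (List.map (_* α (n ℕ.∸ k)) (iterΔₚ (n ℕ.∸ k) (A/n! k))) j ≈ iterΔ (suc n) (λ i → s k i * α (n ℕ.∸ k)) j
      term {k} k≤n = begin
        polyCoeff (List.map (_* α (n ℕ.∸ k)) (iterΔₚ (n ℕ.∸ k) (A/n! k))) j  ≈⟨ polyCoeff-map (_* α (n ℕ.∸ k)) (zeroˡ _) (iterΔₚ (n ℕ.∸ k) (A/n! k)) j ⟩
        polyCoeff (iterΔₚ (n ℕ.∸ k) (A/n! k)) j * α (n ℕ.∸ k)                ≈⟨ *-congʳ (polyCoeff-iterΔₚ (n ℕ.∸ k) _ j) ⟩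
        iterΔ (n ℕ.∸ k) (polyCoeff (A/n! k)) j * α (n ℕ.∸ k)                 ≈⟨ *-congʳ (iterΔ-cong (n ℕ.∸ k) (polyCoeff-A/n! k) j) ⟩
        iterΔ (n ℕ.∸ k) (iterΔ (suc k) (s k)) j * α (n ℕ.∸ k)                ≡⟨ ≡.cong (λ t → t j * α (n ℕ.∸ k)) (≡.sym (fold-+ (s k) Δ (n ℕ.∸ k))) ⟩
        iterΔ (n ℕ.∸ k ℕ.+ suc k) (s k) j * α (n ℕ.∸ k)                      ≡⟨ ≡.cong (λ t → iterΔ t (s k) j * α (n ℕ.∸ k)) n∸k+1+k≡1+n ⟩
        iterΔ (suc n) (s k) j * α (n ℕ.∸ k)                                  ≈⟨ iterΔ-*ʳ (suc n) (s k) _ j ⟨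
        iterΔ (suc n) (λ i → s k i * α (n ℕ.∸ k)) j                          ∎
        where
        n∸k+1+k≡1+n : n ℕ.∸ k ℕ.+ suc k ≡ suc n
        n∸k+1+k≡1+n = ≡.trans (ℕ.+-suc (n ℕ.∸ k) k) (≡.cong suc (ℕ.m∸n+n≡m k≤n))

    evalPoly-e·d-polynomial : ∀ n → evalPoly (e·d-polynomial n) x ≈ (e · d) n
    evalPoly-e·d-polynomial n = begin
      evalPoly (e·d-polynomial n) x                                                            ≈⟨ evalPoly-sumₚ (suc n) _ ⟩
      sumTo (suc n) (λ k → evalPoly (List.map (_* α (n ℕ.∸ k)) (iterΔₚ (n ℕ.∸ k) (A/n! k))) x)  ≈⟨ sumTo-cong (suc n) term ⟩
      sumTo (suc n) (λ k → e k * d (n ℕ.∸ k))                                                  ∎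
      where
      term : ∀ k → evalPoly (List.map (_* α (n ℕ.∸ k)) (iterΔₚ (n ℕ.∸ k) (A/n! k))) x ≈ e k * d (n ℕ.∸ k)
      term k = begin
        evalPoly (List.map (_* α (n ℕ.∸ k)) (iterΔₚ (n ℕ.∸ k) (A/n! k))) x   ≈⟨ evalPoly-map-* (iterΔₚ (n ℕ.∸ k) (A/n! k)) _ ⟩
        evalPoly (iterΔₚ (n ℕ.∸ k) (A/n! k)) x * α (n ℕ.∸ k)                 ≈⟨ *-congʳ (evalPoly-iterΔₚ (n ℕ.∸ k) _) ⟩
        (pow (1# - x) (n ℕ.∸ k) * evalPoly (A/n! k) x) * α (n ℕ.∸ k)        ≈⟨ *-congʳ (*-congˡ (evalPoly-map-* (A k) _)) ⟩
        (pow (1# - x) (n ℕ.∸ k) * e k) * α (n ℕ.∸ k)                        ≈⟨ xy∙z≈y∙xz _ _ _ ⟩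
        e k * (pow (1# - x) (n ℕ.∸ k) * α (n ℕ.∸ k))                        ≈⟨ *-congˡ (d≈ (n ℕ.∸ k)) ⟨
        e k * d (n ℕ.∸ k)                                                   ∎

    e·d : ∀ m → (e · d) (suc m) ≈ x * e (suc m)
    e·d m = begin
      (e · d) (suc m)                      ≈⟨ evalPoly-e·d-polynomial (suc m) ⟨
      evalPoly (e·d-polynomial (suc m)) x  ≈⟨ evalPoly-cong (e·d-polynomial (suc m)) (0# ∷ A/n! (suc m)) (polyCoeff-e·d-polynomial m) ⟩
      0# + x * evalPoly (A/n! (suc m)) x   ≈⟨ trans (+-identityˡ _) (*-congˡ (evalPoly-map-* (A (suc m)) _)) ⟩
      x * e (suc m)                        ∎

    D : Series
    D = denomS lam x

    d₀≈1 : d 0 ≈ 1#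
    d₀≈1 = trans (*-congˡ ι1⁻¹≈1) (trans (*-identityʳ _) (*-identityʳ 1#))

    D·e₀≈x-1 : (D · e) 0 ≈ x - 1#
    D·e₀≈x-1 = trans (+-identityˡ _) (trans (*-cong (+-congˡ (-‿cong d₀≈1)) e₀≈1) (*-identityʳ _))

    D·e-suc≈0 : ∀ n → (D · e) (suc n) ≈ 0#
    D·e-suc≈0 n = begin
      (D · e) (suc n)                                                        ≈⟨ sumTo-head (suc n) _ ⟩
      (x - d 0) * E + sumTo (suc n) (λ i → - d (suc i) * e (n ℕ.∸ i))
        ≈⟨ +-cong ([y-z]x≈yx-zx _ _ _) (trans (sumTo-cong (suc n) (λ i → sym (-‿distribˡ-* _ _))) (sumTo-neg (suc n) _)) ⟩
      (x * E - d 0 * E) - W                                                  ≈⟨ solve 3 (λ a b w → (a :- b) :- w := a :- (b :+ w)) refl (x * E) (d 0 * E) W ⟩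
      x * E - (d 0 * E + W)                                                  ≈⟨ +-congˡ (-‿cong (trans (sym (sumTo-head (suc n) _)) (·-comm d e (suc n)))) ⟩
      x * E - (e · d) (suc n)                                                ≈⟨ +-congˡ (-‿cong (e·d n)) ⟩
      x * E - x * E                                                          ≈⟨ -‿inverseʳ _ ⟩
      0#                                                                     ∎
      where
      E = e (suc n)
      W = sumTo (suc n) (λ i → d (suc i) * e (n ℕ.∸ i))

    x-1≉0 : ¬ (x - 1# ≈ 0#)
    x-1≉0 x-1≈0 = x≉1 (x∙y⁻¹≈ε⇒x≈y x 1# x-1≈0)


proposition2p1 : ∀ {c ℓ} (F : Char0Field c ℓ) →
    let open Char0Field F
        open FieldDefs F
    in ∀ (lam : Carrier) → ¬ (lam ≈ 0#) →
       ∀ (A : ℕ → List Carrier) → IsDegEulerian lam A →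
       ∀ (x : Carrier) → ¬ (x ≈ 1#) →
       ∀ (n : ℕ) → lhsS lam x n ≈ evalPoly (A n) x * (ιF (n !)) ⁻¹
proposition2p1 F lam _ A isEulerian x x≉1 = *-invS (denomS lam x) e x-1≉0 D·e₀≈x-1 D·e-suc≈0
  where
  open FieldDefs F
  open SeriesInverse F
  open DegenerateEulerian F lam A isEulerian x x≉1
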